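{- Let $G$ be a finite group, let $H$ be a nontrivial subgroup of $G$, and let $x\in G$. Suppose that $HxH\neq Hx^{ -1}H$ and $|HxH|/|H|\in\{1,2\}$. Then there exist $|H|$ pairwise disjoint inverse-closed right transversals of $H$ in $HxH\cup Hx^{ -1}H$. In particular, for any integer $0\leqslant b\leqslant |H|$, there exist $b$ pairwise disjoint right transversals of $H$ in $HxH\cup Hx^{ -1}H$ whose union is inverse-closed.
   Context: $HxH=\{hxh':h,h'\in H\}$ is a double coset; it is a union of right cosets of $H$. For a set $K$ of elements of $G$ that is a union of right cosets of $H$, a right transversal of $H$ in $K$ is a subset of $G$ formed by taking exactly one element from each right coset of $H$ contained in $K$. A subset $R$ is inverse-closed if $R^{ -1}=R$. -}

module Defs where

open import Level using (0ℓ)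
open import Data.Nat using (ℕ)
open import Data.Fin using (Fin; _≟_)
open import Data.Fin.Properties using (any?)
open import Data.Fin.Subset using (Subset; _∈_; _⊆_; _∪_)
open import Data.Fin.Subset.Properties using (_∈?_)
open import Data.Vec using (tabulate)
open import Data.Product using (Σ; ∃; _×_; _,_)
open import Data.Empty using (⊥)
open import Relation.Nullary using (¬_; does)
open import Relation.Nullary.Decidable using (_×-dec_)
open import Relation.Binary.PropositionalEquality using (_≡_)
open import Algebra.Structures using (IsGroup)

record FiniteGroup : Set₁ where
  field
    order : ℕ
    _∙_   : Fin order → Fin order → Fin order
    ε     : Fin order
    _⁻¹   : Fin order → Fin order
    isGroup : IsGroup {A = Fin order} _≡_ _∙_ ε _⁻¹
  infixl 7 _∙_
  infix 8 _⁻¹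

module _ (G : FiniteGroup) where
  open FiniteGroup G

  IsSubgroup : Subset order → Set
  IsSubgroup H = (ε ∈ H)
               × (∀ {a b} → a ∈ H → b ∈ H → a ∙ b ∈ H)
               × (∀ {a} → a ∈ H → a ⁻¹ ∈ H)

  Nontrivial : Subset order → Set
  Nontrivial H = ∃ λ h → h ∈ H × ¬ (h ≡ ε)

  doubleCoset : Subset order → Fin order → Subset order
  doubleCoset H x = tabulate λ y →
    does (any? λ h → any? λ h' → (h ∈? H) ×-dec ((h' ∈? H) ×-dec (y ≟ h ∙ x ∙ h')))

  -- t and y lie in the same right coset of H:  Ht = Hy  iff  t y⁻¹ ∈ H
  SameRightCoset : Subset order → Fin order → Fin order → Set
  SameRightCoset H t y = t ∙ y ⁻¹ ∈ H

  IsRightTransversal : Subset order → Subset order → Subset order → Set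
  IsRightTransversal H K T =
      (T ⊆ K)
    × (∀ {y} → y ∈ K → ∃ λ t → t ∈ T × SameRightCoset H t y)
    × (∀ {t t'} → t ∈ T → t' ∈ T → SameRightCoset H t t' → t ≡ t')

  InverseClosed : Subset order → Set
  InverseClosed T = ∀ {t} → t ∈ T → t ⁻¹ ∈ T

  PairwiseDisjoint : {b : ℕ} → (Fin b → Subset order) → Set
  PairwiseDisjoint T = ∀ i j → ¬ (i ≡ j) → ∀ y → y ∈ T i → y ∈ T j → ⊥

  UnionInverseClosed : {b : ℕ} → (Fin b → Subset order) → Set
  UnionInverseClosed T = ∀ i y → y ∈ T i → ∃ λ j → y ⁻¹ ∈ T j

-- A right transversal of H in HxH ∪ Hx⁻¹H is the union of one in HxH and one in Hx⁻¹H (distinct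
-- double cosets share no right coset), and inversion turns left transversals of H in HxH into
-- right transversals of H in Hx⁻¹H. So it suffices to attach to each of the |H| elements a = hx
-- of Hx a set {a, β a} which is at once a right and a left transversal of H in HxH: then
-- {a, β a, a⁻¹, (β a)⁻¹} is an inverse-closed right transversal, and for injective β these sets
-- are pairwise disjoint. If HxH = Hx = xH take β a = a. If HxH consists of the right cosets Hx, Hxk
-- and the left cosets xH, gxH (g, k ∈ H), take β a = g a k: right multiplication by k swaps the
-- two right cosets without moving left cosets, and left multiplication by g swaps the two left
-- cosets. Left cosets are handled as the right cosets of the opposite group.

module Submission where

open import Defs
open import Level using (0ℓ)
open import Data.Bool using (Bool; true; false; if_then_else_)
open import Data.Nat using (ℕ; zero; suc; _≤_; _<_; _*_; _+_; z≤n)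
import Data.Nat.Properties as ℕ
open import Data.Nat.Properties using (+-0-commutativeMonoid)
open import Algebra.Properties.CommutativeMonoid.Sum +-0-commutativeMonoid using (sum; sum-permute)
open import Data.Fin using (Fin; zero; suc; _≟_; inject≤)
open import Data.Fin.Properties using (any?; suc-injective; inject≤-injective)
open import Data.Fin.Permutation using (Permutation′; permutation; _⟨$⟩ʳ_)
open import Data.Fin.Subset using (Subset; ∣_∣; _∪_; _∈_; _∉_; _⊆_; ⁅_⁆; inside; outside)
open import Data.Fin.Subset.Properties
  using (_∈?_; x∈p∪q⁻; x∈p∪q⁺; x∈⁅x⁆; x∈⁅y⁆⇒x≡y; p⊂q⇒∣p∣<∣q∣; p⊆q⇒∣p∣≤∣q∣; ⊆-antisym; x∈p⇒∣p-x∣<∣p∣)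
open import Data.Vec using (tabulate; _∷_; []; here; there)
open import Data.Vec.Properties using (lookup∘tabulate; []=⇒lookup; lookup⇒[]=)
open import Data.Product using (Σ; ∃; _×_; _,_; proj₁; proj₂)
open import Data.Sum using (_⊎_; inj₁; inj₂; [_,_]′)
import Data.Sum as Sum
open import Data.Empty using (⊥-elim)
open import Function using (id; _∘_; flip; Injective)
open import Relation.Nullary using (¬_; does; yes; no; ¬?)
open import Relation.Nullary.Decidable using (_×-dec_; dec-true; decidable-stable)
open import Relation.Unary using (Pred; Decidable)
open import Relation.Binary.PropositionalEquality
open import Algebra.Structures using (IsGroup)
open import Algebra.Bundles using (Group)
import Algebra.Properties.Group as GroupProperties
import Algebra.Construct.Flip.Op as Flip

⟦_⟧ : ∀ {n} {P : Pred (Fin n) 0ℓ} → Decidable P → Subset n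
⟦ P? ⟧ = tabulate (does ∘ P?)

module _ {n} {P : Pred (Fin n) 0ℓ} (P? : Decidable P) where

  ∈⟦⟧⁻ : ∀ {y} → y ∈ ⟦ P? ⟧ → P y
  ∈⟦⟧⁻ {y} y∈ with P? y | trans (sym (lookup∘tabulate (does ∘ P?) y)) ([]=⇒lookup y∈)
  ... | yes py | _ = py

  ∈⟦⟧⁺ : ∀ {y} → P y → y ∈ ⟦ P? ⟧
  ∈⟦⟧⁺ {y} py = lookup⇒[]= y _ (trans (lookup∘tabulate (does ∘ P?) y) (dec-true (P? y) py))

⟦∈?⟧ : ∀ {n} (p : Subset n) → ⟦ (_∈? p) ⟧ ≡ p
⟦∈?⟧ p = ⊆-antisym (∈⟦⟧⁻ (_∈? p)) (∈⟦⟧⁺ (_∈? p))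

∣tabulate∣≡sum : ∀ {n} (f : Fin n → Bool) → ∣ tabulate f ∣ ≡ sum (λ i → if f i then 1 else 0)
∣tabulate∣≡sum {zero}  f = refl
∣tabulate∣≡sum {suc n} f with f zero
... | true  = cong suc (∣tabulate∣≡sum (f ∘ suc))
... | false = ∣tabulate∣≡sum (f ∘ suc)

∣tabulate∘⟨$⟩ʳ∣ : ∀ {n} (f : Fin n → Bool) (π : Permutation′ n) →
                 ∣ tabulate (f ∘ (π ⟨$⟩ʳ_)) ∣ ≡ ∣ tabulate f ∣
∣tabulate∘⟨$⟩ʳ∣ f π = begin
  ∣ tabulate (f ∘ (π ⟨$⟩ʳ_)) ∣                 ≡⟨ ∣tabulate∣≡sum (f ∘ (π ⟨$⟩ʳ_)) ⟩
  sum (λ i → if f (π ⟨$⟩ʳ i) then 1 else 0)  ≡⟨ sum-permute (λ i → if f i then 1 else 0) π ⟨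
  sum (λ i → if f i then 1 else 0)            ≡⟨ ∣tabulate∣≡sum f ⟨
  ∣ tabulate f ∣                              ∎
  where open ≡-Reasoning

p⊆q⇒∣q∣≤∣p∣⇒q⊆p : ∀ {n} {p q : Subset n} → p ⊆ q → ∣ q ∣ ≤ ∣ p ∣ → q ⊆ p
p⊆q⇒∣q∣≤∣p∣⇒q⊆p {p = p} p⊆q ∣q∣≤∣p∣ {y} y∈q with y ∈? p
... | yes y∈p = y∈p
... | no  y∉p = ⊥-elim (ℕ.<⇒≱ (p⊂q⇒∣p∣<∣q∣ (p⊆q , y , y∈q , y∉p)) ∣q∣≤∣p∣)

disjoint⇒∣p∪q∣≡∣p∣+∣q∣ : ∀ {n} (p q : Subset n) → (∀ {y} → y ∈ p → y ∉ q) →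
                         ∣ p ∪ q ∣ ≡ ∣ p ∣ + ∣ q ∣
disjoint⇒∣p∪q∣≡∣p∣+∣q∣ []            []            _ = refl
disjoint⇒∣p∪q∣≡∣p∣+∣q∣ (inside  ∷ p) (inside  ∷ q) d = ⊥-elim (d here here)
disjoint⇒∣p∪q∣≡∣p∣+∣q∣ (inside  ∷ p) (outside ∷ q) d =
  cong suc (disjoint⇒∣p∪q∣≡∣p∣+∣q∣ p q (λ y∈p y∈q → d (there y∈p) (there y∈q)))
disjoint⇒∣p∪q∣≡∣p∣+∣q∣ (outside ∷ p) (inside  ∷ q) d =
  trans (cong suc (disjoint⇒∣p∪q∣≡∣p∣+∣q∣ p q (λ y∈p y∈q → d (there y∈p) (there y∈q))))
        (sym (ℕ.+-suc ∣ p ∣ ∣ q ∣))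
disjoint⇒∣p∪q∣≡∣p∣+∣q∣ (outside ∷ p) (outside ∷ q) d =
  disjoint⇒∣p∪q∣≡∣p∣+∣q∣ p q (λ y∈p y∈q → d (there y∈p) (there y∈q))

x∈p⇒0<∣p∣ : ∀ {n} {p : Subset n} {x} → x ∈ p → 0 < ∣ p ∣
x∈p⇒0<∣p∣ x∈p = ℕ.≤-<-trans z≤n (x∈p⇒∣p-x∣<∣p∣ x∈p)

x∈⁅y⁆∪⁅z⁆⁻ : ∀ {n} {x y z : Fin n} → x ∈ ⁅ y ⁆ ∪ ⁅ z ⁆ → x ≡ y ⊎ x ≡ z
x∈⁅y⁆∪⁅z⁆⁻ {y = y} {z} x∈ = Sum.map (x∈⁅y⁆⇒x≡y y) (x∈⁅y⁆⇒x≡y z) (x∈p∪q⁻ _ _ x∈)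

x∈⁅y⁆∪⁅z⁆⁺ : ∀ {n} {x y z : Fin n} → x ≡ y ⊎ x ≡ z → x ∈ ⁅ y ⁆ ∪ ⁅ z ⁆
x∈⁅y⁆∪⁅z⁆⁺ {x = x} (inj₁ refl) = x∈p∪q⁺ (inj₁ (x∈⁅x⁆ x))
x∈⁅y⁆∪⁅z⁆⁺ {x = x} (inj₂ refl) = x∈p∪q⁺ {p = ⁅ _ ⁆} (inj₂ (x∈⁅x⁆ x))

enumerate : ∀ {n} (p : Subset n) → Fin ∣ p ∣ → Fin n
enumerate (inside  ∷ p) zero    = zero
enumerate (inside  ∷ p) (suc i) = suc (enumerate p i)
enumerate (outside ∷ p) i       = suc (enumerate p i)

enumerate-∈ : ∀ {n} (p : Subset n) i → enumerate p i ∈ p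
enumerate-∈ (inside  ∷ p) zero    = here
enumerate-∈ (inside  ∷ p) (suc i) = there (enumerate-∈ p i)
enumerate-∈ (outside ∷ p) i       = there (enumerate-∈ p i)

enumerate-injective : ∀ {n} (p : Subset n) {i j} → enumerate p i ≡ enumerate p j → i ≡ j
enumerate-injective (inside  ∷ p) {zero}  {zero}  _ = refl
enumerate-injective (inside  ∷ p) {suc i} {suc j} e = cong suc (enumerate-injective p (suc-injective e))
enumerate-injective (outside ∷ p)                 e = enumerate-injective p (suc-injective e)

toGroup : FiniteGroup → Group 0ℓ 0ℓ
toGroup G = record { isGroup = FiniteGroup.isGroup G }

opposite : FiniteGroup → FiniteGroup
opposite G = record
  { order = order ; _∙_ = flip _∙_ ; ε = ε ; _⁻¹ = _⁻¹ ; isGroup = Flip.isGroup isGroup }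
  where open FiniteGroup G

opposite-isSubgroup : ∀ {G H} → IsSubgroup G H → IsSubgroup (opposite G) H
opposite-isSubgroup (ε∈H , ∙-∈H , ⁻¹-∈H) = ε∈H , flip ∙-∈H , ⁻¹-∈H

module Cosets (G : FiniteGroup) {H : Subset (FiniteGroup.order G)} (H≤G : IsSubgroup G H) where
  open FiniteGroup G
  open IsGroup isGroup using (assoc; identityˡ; identityʳ; inverseʳ; _//_)
  open GroupProperties (toGroup G)
    using (⁻¹-anti-homo-∙; ⁻¹-anti-homo-//; //-rightDividesˡ; //-rightDividesʳ; \\-leftDividesʳ)

  ε∈H : ε ∈ H
  ε∈H = proj₁ H≤G

  ∙-∈H : ∀ {a b} → a ∈ H → b ∈ H → a ∙ b ∈ H
  ∙-∈H = proj₁ (proj₂ H≤G)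

  ⁻¹-∈H : ∀ {a} → a ∈ H → a ⁻¹ ∈ H
  ⁻¹-∈H = proj₂ (proj₂ H≤G)

  infix 4 _∼_
  _∼_ : Fin order → Fin order → Set
  _∼_ = SameRightCoset G H

  ∼-refl : ∀ {t} → t ∼ t
  ∼-refl {t} = subst (_∈ H) (sym (inverseʳ t)) ε∈H

  ∼-sym : ∀ {t y} → t ∼ y → y ∼ t
  ∼-sym {t} {y} t∼y = subst (_∈ H) (⁻¹-anti-homo-// t y) (⁻¹-∈H t∼y)

  ∼-trans : ∀ {t y z} → t ∼ y → y ∼ z → t ∼ z
  ∼-trans {t} {y} {z} t∼y y∼z = subst (_∈ H) eq (∙-∈H t∼y y∼z)
    where
    open ≡-Reasoning
    eq : (t // y) ∙ (y // z) ≡ t // z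
    eq = begin
      (t // y) ∙ (y ∙ z ⁻¹)  ≡⟨ assoc (t // y) y (z ⁻¹) ⟨
      ((t // y) ∙ y) ∙ z ⁻¹  ≡⟨ cong (_∙ z ⁻¹) (//-rightDividesˡ y t) ⟩
      t // z                 ∎

  //-∙ʳ : ∀ t y k → (t ∙ k) // (y ∙ k) ≡ t // y
  //-∙ʳ t y k = begin
    (t ∙ k) ∙ (y ∙ k) ⁻¹     ≡⟨ cong ((t ∙ k) ∙_) (⁻¹-anti-homo-∙ y k) ⟩
    (t ∙ k) ∙ (k ⁻¹ ∙ y ⁻¹)  ≡⟨ assoc (t ∙ k) (k ⁻¹) (y ⁻¹) ⟨
    ((t ∙ k) // k) ∙ y ⁻¹    ≡⟨ cong (_∙ y ⁻¹) (//-rightDividesʳ k t) ⟩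
    t // y                   ∎
    where open ≡-Reasoning

  ∼-∙ʳ : ∀ {t y} k → t ∼ y → t ∙ k ∼ y ∙ k
  ∼-∙ʳ {t} {y} k = subst (_∈ H) (sym (//-∙ʳ t y k))

  ∼-∙ʳ⁻ : ∀ {t y} k → t ∙ k ∼ y ∙ k → t ∼ y
  ∼-∙ʳ⁻ {t} {y} k = subst (_∈ H) (//-∙ʳ t y k)

  ∈H⇒∙∼ : ∀ {h} y → h ∈ H → h ∙ y ∼ y
  ∈H⇒∙∼ {h} y = subst (_∈ H) (sym (//-rightDividesʳ y h))

  InDoubleCoset : Fin order → Fin order → Set
  InDoubleCoset x y = ∃ λ h → ∃ λ h' → h ∈ H × h' ∈ H × y ≡ h ∙ x ∙ h'

  inDoubleCoset? : ∀ x → Decidable (InDoubleCoset x)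
  inDoubleCoset? x y = any? λ h → any? λ h' → (h ∈? H) ×-dec ((h' ∈? H) ×-dec (y ≟ h ∙ x ∙ h'))

  ∈-doubleCoset⁻ : ∀ {x y} → y ∈ doubleCoset G H x → InDoubleCoset x y
  ∈-doubleCoset⁻ {x} = ∈⟦⟧⁻ (inDoubleCoset? x)

  ∈-doubleCoset⁺ : ∀ {x y} → InDoubleCoset x y → y ∈ doubleCoset G H x
  ∈-doubleCoset⁺ {x} = ∈⟦⟧⁺ (inDoubleCoset? x)

  x∈doubleCoset : ∀ {x} → x ∈ doubleCoset G H x
  x∈doubleCoset {x} = ∈-doubleCoset⁺ (ε , ε , ε∈H , ε∈H , sym (trans (identityʳ (ε ∙ x)) (identityˡ x)))

  doubleCoset-∙ˡ : ∀ {x h y} → h ∈ H → y ∈ doubleCoset G H x → h ∙ y ∈ doubleCoset G H x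
  doubleCoset-∙ˡ {x} {h} h∈H y∈D with ∈-doubleCoset⁻ y∈D
  ... | h₁ , h₂ , h₁∈H , h₂∈H , refl = ∈-doubleCoset⁺ (h ∙ h₁ , h₂ , ∙-∈H h∈H h₁∈H , h₂∈H , eq)
    where
    open ≡-Reasoning
    eq : h ∙ (h₁ ∙ x ∙ h₂) ≡ h ∙ h₁ ∙ x ∙ h₂
    eq = begin
      h ∙ (h₁ ∙ x ∙ h₂)    ≡⟨ assoc h (h₁ ∙ x) h₂ ⟨
      h ∙ (h₁ ∙ x) ∙ h₂    ≡⟨ cong (_∙ h₂) (assoc h h₁ x) ⟨
      h ∙ h₁ ∙ x ∙ h₂      ∎

  doubleCoset-∙ʳ : ∀ {x h y} → h ∈ H → y ∈ doubleCoset G H x → y ∙ h ∈ doubleCoset G H x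
  doubleCoset-∙ʳ {x} {h} h∈H y∈D with ∈-doubleCoset⁻ y∈D
  ... | h₁ , h₂ , h₁∈H , h₂∈H , refl =
    ∈-doubleCoset⁺ (h₁ , h₂ ∙ h , h₁∈H , ∙-∈H h₂∈H h∈H , assoc (h₁ ∙ x) h₂ h)

  doubleCoset-∼ : ∀ {x y t} → y ∼ t → t ∈ doubleCoset G H x → y ∈ doubleCoset G H x
  doubleCoset-∼ {x} {y} {t} y∼t t∈D = subst (_∈ doubleCoset G H x) (//-rightDividesˡ t y) (doubleCoset-∙ˡ y∼t t∈D)

  doubleCoset-⁻¹ : ∀ {x y} → y ∈ doubleCoset G H x → y ⁻¹ ∈ doubleCoset G H (x ⁻¹)
  doubleCoset-⁻¹ {x} y∈D with ∈-doubleCoset⁻ y∈D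
  ... | h₁ , h₂ , h₁∈H , h₂∈H , refl = ∈-doubleCoset⁺ (h₂ ⁻¹ , h₁ ⁻¹ , ⁻¹-∈H h₂∈H , ⁻¹-∈H h₁∈H , eq)
    where
    open ≡-Reasoning
    eq : (h₁ ∙ x ∙ h₂) ⁻¹ ≡ h₂ ⁻¹ ∙ x ⁻¹ ∙ h₁ ⁻¹
    eq = begin
      (h₁ ∙ x ∙ h₂) ⁻¹           ≡⟨ ⁻¹-anti-homo-∙ (h₁ ∙ x) h₂ ⟩
      h₂ ⁻¹ ∙ (h₁ ∙ x) ⁻¹        ≡⟨ cong (h₂ ⁻¹ ∙_) (⁻¹-anti-homo-∙ h₁ x) ⟩
      h₂ ⁻¹ ∙ (x ⁻¹ ∙ h₁ ⁻¹)     ≡⟨ assoc (h₂ ⁻¹) (x ⁻¹) (h₁ ⁻¹) ⟨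
      h₂ ⁻¹ ∙ x ⁻¹ ∙ h₁ ⁻¹       ∎

  doubleCoset-⊆ : ∀ {x y} → y ∈ doubleCoset G H x → doubleCoset G H y ⊆ doubleCoset G H x
  doubleCoset-⊆ y∈D z∈Dy with ∈-doubleCoset⁻ z∈Dy
  ... | h₁ , h₂ , h₁∈H , h₂∈H , refl = doubleCoset-∙ʳ h₂∈H (doubleCoset-∙ˡ h₁∈H y∈D)

  doubleCoset-sym : ∀ {x y} → y ∈ doubleCoset G H x → x ∈ doubleCoset G H y
  doubleCoset-sym {x} y∈D with ∈-doubleCoset⁻ y∈D
  ... | h₁ , h₂ , h₁∈H , h₂∈H , refl =
    subst (_∈ doubleCoset G H (h₁ ∙ x ∙ h₂)) eq
      (doubleCoset-∙ʳ (⁻¹-∈H h₂∈H) (doubleCoset-∙ˡ (⁻¹-∈H h₁∈H) x∈doubleCoset))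
    where
    open ≡-Reasoning
    eq : h₁ ⁻¹ ∙ (h₁ ∙ x ∙ h₂) ∙ h₂ ⁻¹ ≡ x
    eq = begin
      h₁ ⁻¹ ∙ (h₁ ∙ x ∙ h₂) ∙ h₂ ⁻¹    ≡⟨ cong (_// h₂) (assoc (h₁ ⁻¹) (h₁ ∙ x) h₂) ⟨
      h₁ ⁻¹ ∙ (h₁ ∙ x) ∙ h₂ ∙ h₂ ⁻¹    ≡⟨ //-rightDividesʳ h₂ _ ⟩
      h₁ ⁻¹ ∙ (h₁ ∙ x)                 ≡⟨ \\-leftDividesʳ h₁ x ⟩
      x                                ∎

  doubleCoset-≢⇒disjoint : ∀ {x z y} → doubleCoset G H x ≢ doubleCoset G H z →
                           y ∈ doubleCoset G H x → y ∉ doubleCoset G H z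
  doubleCoset-≢⇒disjoint Dx≢Dz y∈Dx y∈Dz = Dx≢Dz (trans (sym (D≡Dy y∈Dx)) (D≡Dy y∈Dz))
    where
    D≡Dy : ∀ {x y} → y ∈ doubleCoset G H x → doubleCoset G H y ≡ doubleCoset G H x
    D≡Dy y∈D = ⊆-antisym (doubleCoset-⊆ y∈D) (doubleCoset-⊆ (doubleCoset-sym y∈D))

  rightCoset : Fin order → Subset order
  rightCoset z = ⟦ (λ y → (y // z) ∈? H) ⟧

  ∈-rightCoset⁻ : ∀ {z y} → y ∈ rightCoset z → y ∼ z
  ∈-rightCoset⁻ {z} = ∈⟦⟧⁻ (λ y → (y // z) ∈? H)

  ∈-rightCoset⁺ : ∀ {z y} → y ∼ z → y ∈ rightCoset z
  ∈-rightCoset⁺ {z} = ∈⟦⟧⁺ (λ y → (y // z) ∈? H)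

  ∣rightCoset∣ : ∀ z → ∣ rightCoset z ∣ ≡ ∣ H ∣
  ∣rightCoset∣ z = trans (∣tabulate∘⟨$⟩ʳ∣ (does ∘ (_∈? H)) ·z⁻¹) (cong ∣_∣ (⟦∈?⟧ H))
    where
    ·z⁻¹ : Permutation′ order
    ·z⁻¹ = permutation (_// z) (_∙ z) (//-rightDividesʳ z) (//-rightDividesˡ z)

  rightCoset⊆doubleCoset : ∀ {x z} → z ∈ doubleCoset G H x → rightCoset z ⊆ doubleCoset G H x
  rightCoset⊆doubleCoset z∈D y∈Hz = doubleCoset-∼ (∈-rightCoset⁻ y∈Hz) z∈D

  twoClasses : ∀ {K : Subset order} {p q a b} → (∀ {y} → y ∈ K → y ∼ p ⊎ y ∼ q) →
               a ∈ K → b ∈ K → ¬ a ∼ b → ∀ {y} → y ∈ K → a ∼ y ⊎ b ∼ y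
  twoClasses classes a∈K b∈K a≁b y∈K with classes a∈K | classes b∈K | classes y∈K
  ... | inj₁ a∼p | inj₁ b∼p | _       = ⊥-elim (a≁b (∼-trans a∼p (∼-sym b∼p)))
  ... | inj₂ a∼q | inj₂ b∼q | _       = ⊥-elim (a≁b (∼-trans a∼q (∼-sym b∼q)))
  ... | inj₁ a∼p | inj₂ _   | inj₁ y∼p = inj₁ (∼-trans a∼p (∼-sym y∼p))
  ... | inj₁ _   | inj₂ b∼q | inj₂ y∼q = inj₂ (∼-trans b∼q (∼-sym y∼q))
  ... | inj₂ a∼q | inj₁ _   | inj₂ y∼q = inj₁ (∼-trans a∼q (∼-sym y∼q))
  ... | inj₂ _   | inj₁ b∼p | inj₁ y∼p = inj₂ (∼-trans b∼p (∼-sym y∼p))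

  -- a ≡ b is allowed, for a double coset consisting of a single right coset.
  record IsTransversalPair (K : Subset order) (a b : Fin order) : Set where
    field
      a∈K   : a ∈ K
      b∈K   : b ∈ K
      cover : ∀ {y} → y ∈ K → a ∼ y ⊎ b ∼ y
      ∼⇒≡   : a ∼ b → a ≡ b

  IsTransversalPair⇒IsRightTransversal : ∀ {K a b} → IsTransversalPair K a b →
                                         IsRightTransversal G H K (⁅ a ⁆ ∪ ⁅ b ⁆)
  IsTransversalPair⇒IsRightTransversal {K} {a} {b} pair = ⊆K , covers , unique
    where
    open IsTransversalPair pair
    ⊆K : ⁅ a ⁆ ∪ ⁅ b ⁆ ⊆ K
    ⊆K t∈ with x∈⁅y⁆∪⁅z⁆⁻ t∈
    ... | inj₁ refl = a∈K
    ... | inj₂ refl = b∈K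
    covers : ∀ {y} → y ∈ K → ∃ λ t → t ∈ ⁅ a ⁆ ∪ ⁅ b ⁆ × t ∼ y
    covers y∈K with cover y∈K
    ... | inj₁ a∼y = a , x∈⁅y⁆∪⁅z⁆⁺ (inj₁ refl) , a∼y
    ... | inj₂ b∼y = b , x∈⁅y⁆∪⁅z⁆⁺ (inj₂ refl) , b∼y
    unique : ∀ {t t'} → t ∈ ⁅ a ⁆ ∪ ⁅ b ⁆ → t' ∈ ⁅ a ⁆ ∪ ⁅ b ⁆ → t ∼ t' → t ≡ t'
    unique t∈ t'∈ t∼t' with x∈⁅y⁆∪⁅z⁆⁻ t∈ | x∈⁅y⁆∪⁅z⁆⁻ t'∈
    ... | inj₁ refl | inj₁ refl = refl
    ... | inj₂ refl | inj₂ refl = refl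
    ... | inj₁ refl | inj₂ refl = ∼⇒≡ t∼t'
    ... | inj₂ refl | inj₁ refl = sym (∼⇒≡ (∼-sym t∼t'))

  module _ {x : Fin order} where
    private
      D = doubleCoset G H x

    singleCoset-pair : ∣ D ∣ ≡ ∣ H ∣ → ∀ {a} → a ∈ D → IsTransversalPair D a a
    singleCoset-pair ∣D∣≡∣H∣ {a} a∈D = record
      { a∈K = a∈D ; b∈K = a∈D ; ∼⇒≡ = λ _ → refl
      ; cover = λ y∈D → inj₁ (∼-sym (∈-rightCoset⁻ (D⊆Ha y∈D))) }
      where
      D⊆Ha : D ⊆ rightCoset a
      D⊆Ha = p⊆q⇒∣q∣≤∣p∣⇒q⊆p (rightCoset⊆doubleCoset a∈D)
                              (ℕ.≤-reflexive (trans ∣D∣≡∣H∣ (sym (∣rightCoset∣ a))))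

    xH⊈Hx : ∣ D ∣ ≡ 2 * ∣ H ∣ → ∃ λ k → k ∈ H × ¬ x ∙ k ∼ x
    xH⊈Hx ∣D∣≡2∣H∣ with any? (λ k → (k ∈? H) ×-dec ¬? ((x ∙ k // x) ∈? H))
    ... | yes found = found
    ... | no  none  = ⊥-elim (ℕ.<⇒≱ ∣Hx∣<∣D∣ (p⊆q⇒∣p∣≤∣q∣ D⊆Hx))
      where
      xH⊆Hx : ∀ {k} → k ∈ H → x ∙ k ∼ x
      xH⊆Hx {k} k∈H = decidable-stable ((x ∙ k // x) ∈? H) (λ xk≁x → none (k , k∈H , xk≁x))
      D⊆Hx : D ⊆ rightCoset x
      D⊆Hx y∈D with ∈-doubleCoset⁻ y∈D
      ... | h , h' , h∈H , h'∈H , refl = ∈-rightCoset⁺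
        (∼-trans (subst (_∼ x ∙ h') (sym (assoc h x h')) (∈H⇒∙∼ (x ∙ h') h∈H)) (xH⊆Hx h'∈H))
      ∣Hx∣<∣D∣ : ∣ rightCoset x ∣ < ∣ D ∣
      ∣Hx∣<∣D∣ = subst₂ _<_ (sym (∣rightCoset∣ x)) (sym ∣D∣≡2∣H∣)
        (ℕ.m<m+n ∣ H ∣ (subst (0 <_) (sym (ℕ.+-identityʳ ∣ H ∣)) (x∈p⇒0<∣p∣ ε∈H)))

    ⊆Hx∪Hxk : ∣ D ∣ ≡ 2 * ∣ H ∣ → ∀ {k} → k ∈ H → ¬ x ∙ k ∼ x → ∀ {y} → y ∈ D → y ∼ x ⊎ y ∼ x ∙ k
    ⊆Hx∪Hxk ∣D∣≡2∣H∣ {k} k∈H xk≁x y∈D =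
      Sum.map ∈-rightCoset⁻ ∈-rightCoset⁻ (x∈p∪q⁻ Hx Hxk (p⊆q⇒∣q∣≤∣p∣⇒q⊆p Hx∪Hxk⊆D ∣D∣≤∣Hx∪Hxk∣ y∈D))
      where
      Hx Hxk : Subset order
      Hx  = rightCoset x
      Hxk = rightCoset (x ∙ k)
      Hx∪Hxk⊆D : Hx ∪ Hxk ⊆ D
      Hx∪Hxk⊆D = [ rightCoset⊆doubleCoset x∈doubleCoset
                 , rightCoset⊆doubleCoset (doubleCoset-∙ʳ k∈H x∈doubleCoset) ]′ ∘ x∈p∪q⁻ Hx Hxk
      disjoint : ∀ {y} → y ∈ Hx → y ∉ Hxk
      disjoint y∈Hx y∈Hxk = xk≁x (∼-trans (∼-sym (∈-rightCoset⁻ y∈Hxk)) (∈-rightCoset⁻ y∈Hx))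
      ∣D∣≤∣Hx∪Hxk∣ : ∣ D ∣ ≤ ∣ Hx ∪ Hxk ∣
      ∣D∣≤∣Hx∪Hxk∣ = ℕ.≤-reflexive (begin
        ∣ D ∣                ≡⟨ ∣D∣≡2∣H∣ ⟩
        ∣ H ∣ + (∣ H ∣ + 0)   ≡⟨ cong (∣ H ∣ +_) (ℕ.+-identityʳ ∣ H ∣) ⟩
        ∣ H ∣ + ∣ H ∣         ≡⟨ cong₂ _+_ (∣rightCoset∣ x) (∣rightCoset∣ (x ∙ k)) ⟨
        ∣ Hx ∣ + ∣ Hxk ∣      ≡⟨ disjoint⇒∣p∪q∣≡∣p∣+∣q∣ Hx Hxk disjoint ⟨
        ∣ Hx ∪ Hxk ∣          ∎)
        where open ≡-Reasoning

    -- Right multiplication by k permutes the two right cosets Hx, Hxk of D and moves Hx.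
    ∙k-apart : ∀ {k} → (∀ {y} → y ∈ D → y ∼ x ⊎ y ∼ x ∙ k) → ¬ x ∙ k ∼ x →
               ∀ {a} → a ∈ D → ¬ a ∼ a ∙ k
    ∙k-apart {k} classes xk≁x a∈D a∼ak with classes a∈D
    ... | inj₁ a∼x  = xk≁x (∼-sym (∼-trans (∼-sym a∼x) (∼-trans a∼ak (∼-∙ʳ k a∼x))))
    ... | inj₂ a∼xk = xk≁x (∼-sym (∼-∙ʳ⁻ k (∼-trans (∼-sym a∼xk) (∼-trans a∼ak (∼-∙ʳ k a∼xk)))))

    twoCosets-pair : ∣ D ∣ ≡ 2 * ∣ H ∣ →
                     ∃ λ k → k ∈ H × ∀ {h a} → h ∈ H → a ∈ D → IsTransversalPair D a (h ∙ (a ∙ k))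
    twoCosets-pair ∣D∣≡2∣H∣ with xH⊈Hx ∣D∣≡2∣H∣
    ... | k , k∈H , xk≁x = k , k∈H , pair
      where
      pair : ∀ {h a} → h ∈ H → a ∈ D → IsTransversalPair D a (h ∙ (a ∙ k))
      pair {h} {a} h∈H a∈D = record
        { a∈K   = a∈D
        ; b∈K   = doubleCoset-∙ˡ h∈H ak∈D
        ; cover = Sum.map₂ (∼-trans hak∼ak) ∘ twoClasses classes a∈D ak∈D a≁ak
        ; ∼⇒≡   = λ a∼hak → ⊥-elim (a≁ak (∼-trans a∼hak hak∼ak))
        }
        where
        classes : ∀ {y} → y ∈ D → y ∼ x ⊎ y ∼ x ∙ k
        classes = ⊆Hx∪Hxk ∣D∣≡2∣H∣ k∈H xk≁x
        ak∈D : a ∙ k ∈ D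
        ak∈D = doubleCoset-∙ʳ k∈H a∈D
        a≁ak : ¬ a ∼ a ∙ k
        a≁ak = ∙k-apart classes xk≁x a∈D
        hak∼ak : h ∙ (a ∙ k) ∼ a ∙ k
        hak∼ak = ∈H⇒∙∼ (a ∙ k) h∈H

  ∪-isRightTransversal : ∀ {K₁ K₂ T₁ T₂} →
    IsRightTransversal G H K₁ T₁ → IsRightTransversal G H K₂ T₂ →
    (∀ {t y} → t ∈ K₁ → y ∈ K₂ → ¬ t ∼ y) → IsRightTransversal G H (K₁ ∪ K₂) (T₁ ∪ T₂)
  ∪-isRightTransversal {K₁} {K₂} {T₁} {T₂} (T₁⊆K₁ , cover₁ , unique₁) (T₂⊆K₂ , cover₂ , unique₂) apart =
    T⊆K , cover , unique
    where
    T⊆K : T₁ ∪ T₂ ⊆ K₁ ∪ K₂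
    T⊆K = x∈p∪q⁺ ∘ Sum.map T₁⊆K₁ T₂⊆K₂ ∘ x∈p∪q⁻ T₁ T₂
    cover : ∀ {y} → y ∈ K₁ ∪ K₂ → ∃ λ t → t ∈ T₁ ∪ T₂ × t ∼ y
    cover y∈K with x∈p∪q⁻ K₁ K₂ y∈K
    ... | inj₁ y∈K₁ = let t , t∈T₁ , t∼y = cover₁ y∈K₁ in t , x∈p∪q⁺ (inj₁ t∈T₁) , t∼y
    ... | inj₂ y∈K₂ = let t , t∈T₂ , t∼y = cover₂ y∈K₂ in t , x∈p∪q⁺ {p = T₁} (inj₂ t∈T₂) , t∼y
    unique : ∀ {t t'} → t ∈ T₁ ∪ T₂ → t' ∈ T₁ ∪ T₂ → t ∼ t' → t ≡ t'
    unique t∈T t'∈T t∼t' with x∈p∪q⁻ T₁ T₂ t∈T | x∈p∪q⁻ T₁ T₂ t'∈T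
    ... | inj₁ t∈T₁ | inj₁ t'∈T₁ = unique₁ t∈T₁ t'∈T₁ t∼t'
    ... | inj₂ t∈T₂ | inj₂ t'∈T₂ = unique₂ t∈T₂ t'∈T₂ t∼t'
    ... | inj₁ t∈T₁ | inj₂ t'∈T₂ = ⊥-elim (apart (T₁⊆K₁ t∈T₁) (T₂⊆K₂ t'∈T₂) t∼t')
    ... | inj₂ t∈T₂ | inj₁ t'∈T₁ = ⊥-elim (apart (T₁⊆K₁ t'∈T₁) (T₂⊆K₂ t∈T₂) (∼-sym t∼t'))

module TwoSided (G : FiniteGroup) {H : Subset (FiniteGroup.order G)} (H≤G : IsSubgroup G H) where
  open FiniteGroup G
  open IsGroup isGroup using (assoc)
  open GroupProperties (toGroup G) using (⁻¹-involutive; ⁻¹-anti-homo-∙; ∙-cancelˡ; ∙-cancelʳ)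
  open Cosets G H≤G
  module ᵒᵖ = Cosets (opposite G) {H} (opposite-isSubgroup {G} H≤G)

  -- The right cosets of H in the opposite group are the left cosets of H in G.
  IsLeftTransversalPair : Subset order → Fin order → Fin order → Set
  IsLeftTransversalPair = ᵒᵖ.IsTransversalPair

  opposite-doubleCoset : ∀ x → doubleCoset (opposite G) H x ≡ doubleCoset G H x
  opposite-doubleCoset x = ⊆-antisym
    (λ y∈D → ∈-doubleCoset⁺ (fromᵒᵖ (ᵒᵖ.∈-doubleCoset⁻ y∈D)))
    (λ y∈D → ᵒᵖ.∈-doubleCoset⁺ (toᵒᵖ (∈-doubleCoset⁻ y∈D)))
    where
    fromᵒᵖ : ∀ {y} → ᵒᵖ.InDoubleCoset x y → InDoubleCoset x y
    fromᵒᵖ (h , h' , h∈H , h'∈H , e) = h' , h , h'∈H , h∈H , trans e (sym (assoc h' x h))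
    toᵒᵖ : ∀ {y} → InDoubleCoset x y → ᵒᵖ.InDoubleCoset x y
    toᵒᵖ (h , h' , h∈H , h'∈H , e) = h' , h , h'∈H , h∈H , trans e (assoc h x h')

  ∼ᵒᵖ⇒⁻¹∼⁻¹ : ∀ {t y} → t ᵒᵖ.∼ y → t ⁻¹ ∼ y ⁻¹
  ∼ᵒᵖ⇒⁻¹∼⁻¹ {t} {y} t∼y = subst (_∈ H) (⁻¹-anti-homo-∙ (y ⁻¹) t) (⁻¹-∈H t∼y)

  ⁻¹∼⁻¹⇒∼ᵒᵖ : ∀ {t y} → t ⁻¹ ∼ y ⁻¹ → t ᵒᵖ.∼ y
  ⁻¹∼⁻¹⇒∼ᵒᵖ {t} {y} t⁻¹∼y⁻¹ = subst (λ u → y ⁻¹ ∙ u ∈ H) (⁻¹-involutive t) (∼-sym t⁻¹∼y⁻¹)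

  ⁻¹-pair : ∀ {K K' a b} → (∀ {y} → y ∈ K → y ⁻¹ ∈ K') → (∀ {y} → y ∈ K' → y ⁻¹ ∈ K) →
            IsLeftTransversalPair K a b → IsTransversalPair K' (a ⁻¹) (b ⁻¹)
  ⁻¹-pair K⁻¹⊆K' K'⁻¹⊆K pair = record
    { a∈K   = K⁻¹⊆K' a∈K
    ; b∈K   = K⁻¹⊆K' b∈K
    ; cover = Sum.map ∼ᵒᵖ⁻¹ ∼ᵒᵖ⁻¹ ∘ cover ∘ K'⁻¹⊆K
    ; ∼⇒≡   = cong _⁻¹ ∘ ∼⇒≡ ∘ ⁻¹∼⁻¹⇒∼ᵒᵖ
    }
    where
    open ᵒᵖ.IsTransversalPair pair
    ∼ᵒᵖ⁻¹ : ∀ {t y} → t ᵒᵖ.∼ y ⁻¹ → t ⁻¹ ∼ y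
    ∼ᵒᵖ⁻¹ {t} {y} t∼y⁻¹ = subst (t ⁻¹ ∼_) (⁻¹-involutive y) (∼ᵒᵖ⇒⁻¹∼⁻¹ t∼y⁻¹)

  module _ {x : Fin order} where
    private
      D : Subset order
      D = doubleCoset G H x

    fromOpposite : ∀ {β : Fin order → Fin order} →
      (∀ {a} → a ∈ doubleCoset (opposite G) H x → ᵒᵖ.IsTransversalPair (doubleCoset (opposite G) H x) a (β a)) →
      ∀ {a} → a ∈ D → IsLeftTransversalPair D a (β a)
    fromOpposite {β} pairᵒᵖ {a} a∈D = subst (λ K → IsLeftTransversalPair K a (β a)) (opposite-doubleCoset x)
      (pairᵒᵖ (subst (a ∈_) (sym (opposite-doubleCoset x)) a∈D))

    ∣Dᵒᵖ∣≡∣D∣ : ∣ doubleCoset (opposite G) H x ∣ ≡ ∣ D ∣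
    ∣Dᵒᵖ∣≡∣D∣ = cong ∣_∣ (opposite-doubleCoset x)

    transversalPairing : ∣ D ∣ ≡ ∣ H ∣ ⊎ ∣ D ∣ ≡ 2 * ∣ H ∣ →
      Σ (Fin order → Fin order) λ β → Injective _≡_ _≡_ β ×
        (∀ {a} → a ∈ D → IsTransversalPair D a (β a) × IsLeftTransversalPair D a (β a))
    transversalPairing (inj₁ ∣D∣≡∣H∣) =
      id , id , λ a∈D → singleCoset-pair ∣D∣≡∣H∣ a∈D ,
                        fromOpposite (ᵒᵖ.singleCoset-pair (trans ∣Dᵒᵖ∣≡∣D∣ ∣D∣≡∣H∣)) a∈D
    transversalPairing (inj₂ ∣D∣≡2∣H∣)
      with twoCosets-pair ∣D∣≡2∣H∣ | ᵒᵖ.twoCosets-pair (trans ∣Dᵒᵖ∣≡∣D∣ ∣D∣≡2∣H∣)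
    ... | k , k∈H , rightPair | g , g∈H , leftPair =
      β , β-injective , λ a∈D → right a∈D , fromOpposite (leftPair k∈H) a∈D
      where
      β : Fin order → Fin order
      β a = g ∙ a ∙ k
      β-injective : Injective _≡_ _≡_ β
      β-injective {a} {b} = ∙-cancelˡ g a b ∘ ∙-cancelʳ k (g ∙ a) (g ∙ b)
      right : ∀ {a} → a ∈ D → IsTransversalPair D a (β a)
      right {a} a∈D = subst (IsTransversalPair D a) (sym (assoc g a k)) (rightPair g∈H a∈D)

  ⁻¹-∈⁅⁆∪⁅⁆ : ∀ {a b y} → y ∈ ⁅ a ⁆ ∪ ⁅ b ⁆ → y ⁻¹ ∈ ⁅ a ⁻¹ ⁆ ∪ ⁅ b ⁻¹ ⁆
  ⁻¹-∈⁅⁆∪⁅⁆ = x∈⁅y⁆∪⁅z⁆⁺ ∘ Sum.map (cong _⁻¹) (cong _⁻¹) ∘ x∈⁅y⁆∪⁅z⁆⁻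

  ⁻¹-∈⁅⁻¹⁆∪⁅⁻¹⁆ : ∀ {a b y} → y ∈ ⁅ a ⁻¹ ⁆ ∪ ⁅ b ⁻¹ ⁆ → y ⁻¹ ∈ ⁅ a ⁆ ∪ ⁅ b ⁆
  ⁻¹-∈⁅⁻¹⁆∪⁅⁻¹⁆ {a} {b} = x∈⁅y⁆∪⁅z⁆⁺ ∘ Sum.map (cancel a) (cancel b) ∘ x∈⁅y⁆∪⁅z⁆⁻
    where
    cancel : ∀ c {y} → y ≡ c ⁻¹ → y ⁻¹ ≡ c
    cancel c e = trans (cong _⁻¹ e) (⁻¹-involutive c)

  module Family {x : Fin order} (Dx≢Dx⁻¹ : doubleCoset G H x ≢ doubleCoset G H (x ⁻¹))
           {β : Fin order → Fin order} (β-injective : Injective _≡_ _≡_ β)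
           (pairs : ∀ {a} → a ∈ doubleCoset G H x →
                    IsTransversalPair (doubleCoset G H x) a (β a) × IsLeftTransversalPair (doubleCoset G H x) a (β a))
           where
    private
      D D⁻¹ : Subset order
      D   = doubleCoset G H x
      D⁻¹ = doubleCoset G H (x ⁻¹)

    element : Fin ∣ H ∣ → Fin order
    element i = enumerate H i ∙ x

    element∈D : ∀ i → element i ∈ D
    element∈D i = doubleCoset-∙ˡ (enumerate-∈ H i) x∈doubleCoset

    element-∼ : ∀ i j → element i ∼ element j
    element-∼ i j = ∼-trans (∈H⇒∙∼ x (enumerate-∈ H i)) (∼-sym (∈H⇒∙∼ x (enumerate-∈ H j)))

    element-injective : ∀ {i j} → element i ≡ element j → i ≡ j
    element-injective {i} {j} = enumerate-injective H ∘ ∙-cancelʳ x (enumerate H i) (enumerate H j)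

    element≡β⇒≡ : ∀ {i j} → element i ≡ β (element j) → i ≡ j
    element≡β⇒≡ {i} {j} e = element-injective (trans e (sym (∼⇒≡ (subst (element j ∼_) e (element-∼ j i)))))
      where open IsTransversalPair (proj₁ (pairs (element∈D j)))

    P P⁻¹ transversal : Fin ∣ H ∣ → Subset order
    P   i = ⁅ element i ⁆ ∪ ⁅ β (element i) ⁆
    P⁻¹ i = ⁅ element i ⁻¹ ⁆ ∪ ⁅ β (element i) ⁻¹ ⁆
    transversal i = P i ∪ P⁻¹ i

    P-isRightTransversal : ∀ i → IsRightTransversal G H D (P i)
    P-isRightTransversal i = IsTransversalPair⇒IsRightTransversal (proj₁ (pairs (element∈D i)))

    P⁻¹-isRightTransversal : ∀ i → IsRightTransversal G H D⁻¹ (P⁻¹ i)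
    P⁻¹-isRightTransversal i =
      IsTransversalPair⇒IsRightTransversal (⁻¹-pair doubleCoset-⁻¹ D⁻¹⁻¹⊆D (proj₂ (pairs (element∈D i))))
      where
      D⁻¹⁻¹⊆D : ∀ {y} → y ∈ D⁻¹ → y ⁻¹ ∈ D
      D⁻¹⁻¹⊆D {y} y∈D⁻¹ = subst (λ z → y ⁻¹ ∈ doubleCoset G H z) (⁻¹-involutive x) (doubleCoset-⁻¹ y∈D⁻¹)

    P-meet⇒≡ : ∀ {i j y} → y ∈ P i → y ∈ P j → i ≡ j
    P-meet⇒≡ y∈Pi y∈Pj with x∈⁅y⁆∪⁅z⁆⁻ y∈Pi | x∈⁅y⁆∪⁅z⁆⁻ y∈Pj
    ... | inj₁ refl | inj₁ e = element-injective e
    ... | inj₂ refl | inj₂ e = element-injective (β-injective e)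
    ... | inj₁ refl | inj₂ e = element≡β⇒≡ e
    ... | inj₂ refl | inj₁ e = sym (element≡β⇒≡ (sym e))

    transversal-isRightTransversal : ∀ i → IsRightTransversal G H (D ∪ D⁻¹) (transversal i)
    transversal-isRightTransversal i =
      ∪-isRightTransversal (P-isRightTransversal i) (P⁻¹-isRightTransversal i) D-apart
      where
      D-apart : ∀ {t y} → t ∈ D → y ∈ D⁻¹ → ¬ t ∼ y
      D-apart t∈D y∈D⁻¹ t∼y = doubleCoset-≢⇒disjoint Dx≢Dx⁻¹ (doubleCoset-∼ (∼-sym t∼y) t∈D) y∈D⁻¹

    transversal-inverseClosed : ∀ i → InverseClosed G (transversal i)
    transversal-inverseClosed i y∈T with x∈p∪q⁻ (P i) (P⁻¹ i) y∈T
    ... | inj₁ y∈P   = x∈p∪q⁺ {p = P i} (inj₂ (⁻¹-∈⁅⁆∪⁅⁆ y∈P))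
    ... | inj₂ y∈P⁻¹ = x∈p∪q⁺ (inj₁ (⁻¹-∈⁅⁻¹⁆∪⁅⁻¹⁆ y∈P⁻¹))

    transversal-pairwiseDisjoint : PairwiseDisjoint G transversal
    transversal-pairwiseDisjoint i j i≢j y y∈Ti y∈Tj with x∈p∪q⁻ (P i) (P⁻¹ i) y∈Ti | x∈p∪q⁻ (P j) (P⁻¹ j) y∈Tj
    ... | inj₁ y∈Pi   | inj₁ y∈Pj   = i≢j (P-meet⇒≡ y∈Pi y∈Pj)
    ... | inj₂ y∈Pi⁻¹ | inj₂ y∈Pj⁻¹ = i≢j (P-meet⇒≡ (⁻¹-∈⁅⁻¹⁆∪⁅⁻¹⁆ y∈Pi⁻¹) (⁻¹-∈⁅⁻¹⁆∪⁅⁻¹⁆ y∈Pj⁻¹))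
    ... | inj₁ y∈Pi   | inj₂ y∈Pj⁻¹ =
      doubleCoset-≢⇒disjoint Dx≢Dx⁻¹ (proj₁ (P-isRightTransversal i) y∈Pi) (proj₁ (P⁻¹-isRightTransversal j) y∈Pj⁻¹)
    ... | inj₂ y∈Pi⁻¹ | inj₁ y∈Pj   =
      doubleCoset-≢⇒disjoint Dx≢Dx⁻¹ (proj₁ (P-isRightTransversal j) y∈Pj) (proj₁ (P⁻¹-isRightTransversal i) y∈Pi⁻¹)

restrict-transversals : (G : FiniteGroup) → let open FiniteGroup G in
  ∀ {H K : Subset order} {n} {T : Fin n → Subset order} →
  (∀ i → IsRightTransversal G H K (T i)) → (∀ i → InverseClosed G (T i)) → PairwiseDisjoint G T →
  ∀ b → b ≤ n →
  Σ (Fin b → Subset order) λ T' →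
    (∀ i → IsRightTransversal G H K (T' i)) × PairwiseDisjoint G T' × UnionInverseClosed G T'
restrict-transversals G {T = T} isRT inverseClosed disjoint b b≤n =
  T ∘ inject ,
  isRT ∘ inject ,
  (λ i j i≢j → disjoint (inject i) (inject j) (i≢j ∘ inject≤-injective b≤n b≤n i j)) ,
  (λ i y y∈ → i , inverseClosed (inject i) y∈)
  where
  inject : Fin b → Fin _
  inject i = inject≤ i b≤n

lemma3p2 : (G : FiniteGroup) → let open FiniteGroup G in
    (H : Subset order) → IsSubgroup G H → Nontrivial G H →
    (x : Fin order) →
    ¬ (doubleCoset G H x ≡ doubleCoset G H (x ⁻¹)) →
    (∣ doubleCoset G H x ∣ ≡ ∣ H ∣ ⊎ ∣ doubleCoset G H x ∣ ≡ 2 * ∣ H ∣) →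
    (Σ (Fin ∣ H ∣ → Subset order) λ T →
        (∀ i → IsRightTransversal G H (doubleCoset G H x ∪ doubleCoset G H (x ⁻¹)) (T i))
      × (∀ i → InverseClosed G (T i))
      × PairwiseDisjoint G T)
    × (∀ (b : ℕ) → b ≤ ∣ H ∣ →
        Σ (Fin b → Subset order) λ T →
            (∀ i → IsRightTransversal G H (doubleCoset G H x ∪ doubleCoset G H (x ⁻¹)) (T i))
          × PairwiseDisjoint G T
          × UnionInverseClosed G T)
lemma3p2 G H H≤G _ x Dx≢Dx⁻¹ ∣Dx∣ with TwoSided.transversalPairing G H≤G ∣Dx∣
... | β , β-injective , pairs =
  (transversal , transversal-isRightTransversal , transversal-inverseClosed , transversal-pairwiseDisjoint) ,
  restrict-transversals G transversal-isRightTransversal transversal-inverseClosed transversal-pairwiseDisjoint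
  where open TwoSided.Family G H≤G Dx≢Dx⁻¹ β-injective pairs
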